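{- Let $r\geq 1$ be an integer and let $M$ be a $2r\times 2r$ 0-1 matrix such that $M_{i,j}=1$ whenever $i>j$ and $M_{i,j}=0$ whenever $i<j$ (the diagonal entries are arbitrary). Then the rank of $M$ over $\mathrm{GF}(2)$ is at least $r$. -}

module Defs where

open import Data.Nat using (ℕ; zero; suc)
open import Data.Fin using (Fin; zero; suc)
open import Data.Bool using (Bool; true; false; _∧_; _xor_)
open import Data.Product using (∃)
open import Relation.Binary.PropositionalEquality using (_≡_)

-- GF(2) is modelled by Bool: addition = xor, multiplication = ∧.

Vec₂ : ℕ → Set
Vec₂ n = Fin n → Bool

Mat₂ : ℕ → ℕ → Set
Mat₂ m n = Fin m → Fin n → Bool

zero₂ : ∀ {n} → Vec₂ n
zero₂ _ = false

_⊕_ : ∀ {n} → Vec₂ n → Vec₂ n → Vec₂ n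
(u ⊕ v) j = u j xor v j

_·_ : ∀ {n} → Bool → Vec₂ n → Vec₂ n
(c · v) j = c ∧ v j

lincomb : ∀ {k n} → (Fin k → Bool) → (Fin k → Vec₂ n) → Vec₂ n
lincomb {zero}  c v = zero₂
lincomb {suc k} c v = (c zero · v zero) ⊕ lincomb (λ i → c (suc i)) (λ i → v (suc i))

LinIndep : ∀ {k n} → (Fin k → Vec₂ n) → Set
LinIndep {k} v = ∀ (c : Fin k → Bool) → (∀ j → lincomb c v j ≡ false) → ∀ i → c i ≡ false

RankAtLeast : ∀ {m n} → Mat₂ m n → ℕ → Set
RankAtLeast {m} M r = ∃ λ (ι : Fin r → Fin m) → LinIndep (λ i → M (ι i))

-- Keep the odd rows 1, 3, …, 2r−1 and the even columns 0, 2, …, 2r−2. Row 2m+1 meets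
-- column 2m strictly below the diagonal and column 2k (k > m) strictly above it, so the
-- resulting r × r submatrix is unitriangular; hence those r rows are linearly independent.
module Submission where

open import Defs
open import Data.Nat using (ℕ; _*_; _<_; _≤_; _≥_; suc; zero; s≤s; z≤n)
open import Data.Nat.Properties using (*-suc; *-monoʳ-≤; n<1+n; <-trans)
open import Data.Fin using (Fin; zero; suc; toℕ; fromℕ<)
open import Data.Fin.Properties using (toℕ-fromℕ<; toℕ<n)
open import Data.Bool using (Bool; true; false)
open import Data.Product using (_,_)
open import Relation.Binary.PropositionalEquality using (_≡_; refl; sym; trans; subst; subst₂)

lincomb-vanishes : ∀ {k n} (c : Fin k → Bool) (v : Fin k → Vec₂ n) j →
                   (∀ i → c i ≡ false) → lincomb c v j ≡ false
lincomb-vanishes {zero}  c v j c≡0 = refl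
lincomb-vanishes {suc k} c v j c≡0
  rewrite c≡0 zero = lincomb-vanishes (λ i → c (suc i)) (λ i → v (suc i)) j (λ i → c≡0 (suc i))

lincomb-tail : ∀ {k n} (c : Fin (suc k) → Bool) (v : Fin (suc k) → Vec₂ n) j →
               v zero j ≡ false →
               lincomb c v j ≡ lincomb (λ i → c (suc i)) (λ i → v (suc i)) j
lincomb-tail c v j v₀j≡0 rewrite v₀j≡0 with c zero
... | true  = refl
... | false = refl

record Unitriangular {n N} (v : Fin n → Vec₂ N) (col : Fin n → Fin N) : Set where
  field
    above    : ∀ m k → toℕ m < toℕ k → v m (col k) ≡ false
    diagonal : ∀ m → v m (col m) ≡ true

open Unitriangular

Unitriangular-tail : ∀ {n N} {v : Fin (suc n) → Vec₂ N} {col : Fin (suc n) → Fin N} →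
                     Unitriangular v col →
                     Unitriangular (λ i → v (suc i)) (λ i → col (suc i))
Unitriangular-tail U = record
  { above    = λ m k m<k → above U (suc m) (suc k) (s≤s m<k)
  ; diagonal = λ m → diagonal U (suc m)
  }

-- Induction on the rows: v 0 is zero on every later selected column, so those columns see
-- only the tail and force its coefficients to vanish; column col 0 then isolates c 0.
Unitriangular⇒trivial-kernel : ∀ {n N} {v : Fin n → Vec₂ N} {col : Fin n → Fin N} →
                               Unitriangular v col → ∀ c →
                               (∀ k → lincomb c v (col k) ≡ false) → ∀ i → c i ≡ false
Unitriangular⇒trivial-kernel {zero}                  U c vanish ()
Unitriangular⇒trivial-kernel {suc n} {v = v} {col} U c vanish = coefficients
  where
  c′ : Fin n → Bool
  c′ i = c (suc i)

  v′ : Fin n → Vec₂ _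
  v′ i = v (suc i)

  tail-vanish : ∀ k → lincomb c′ v′ (col (suc k)) ≡ false
  tail-vanish k = trans (sym (lincomb-tail c v (col (suc k)) (above U zero (suc k) (s≤s z≤n))))
                        (vanish (suc k))

  tail≡0 : ∀ i → c′ i ≡ false
  tail≡0 = Unitriangular⇒trivial-kernel (Unitriangular-tail U) c′ tail-vanish

  head≡0 : c zero ≡ false
  head≡0 with vanish zero
  ... | eq rewrite diagonal U zero | lincomb-vanishes c′ v′ (col zero) tail≡0 with c zero
  ...   | false = refl
  ...   | true  = eq

  coefficients : ∀ i → c i ≡ false
  coefficients zero    = head≡0
  coefficients (suc i) = tail≡0 i

Unitriangular⇒LinIndep : ∀ {n N} {v : Fin n → Vec₂ N} {col : Fin n → Fin N} →
                         Unitriangular v col → LinIndep v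
Unitriangular⇒LinIndep {col = col} U c vanish =
  Unitriangular⇒trivial-kernel U c (λ k → vanish (col k))

1+2m<2k : ∀ {m k} → m < k → suc (2 * m) < 2 * k
1+2m<2k {m} {k} m<k = subst (_≤ 2 * k) (*-suc 2 m) (*-monoʳ-≤ 2 m<k)

evenIndex : ∀ {r} → Fin r → Fin (2 * r)
evenIndex m = fromℕ< (<-trans (n<1+n _) (1+2m<2k (toℕ<n m)))

oddIndex : ∀ {r} → Fin r → Fin (2 * r)
oddIndex m = fromℕ< (1+2m<2k (toℕ<n m))

toℕ-evenIndex : ∀ {r} (m : Fin r) → toℕ (evenIndex m) ≡ 2 * toℕ m
toℕ-evenIndex m = toℕ-fromℕ< _

toℕ-oddIndex : ∀ {r} (m : Fin r) → toℕ (oddIndex m) ≡ suc (2 * toℕ m)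
toℕ-oddIndex m = toℕ-fromℕ< _

oddIndex<evenIndex : ∀ {r} {m k : Fin r} → toℕ m < toℕ k → toℕ (oddIndex m) < toℕ (evenIndex k)
oddIndex<evenIndex {m = m} {k} m<k =
  subst₂ _<_ (sym (toℕ-oddIndex m)) (sym (toℕ-evenIndex k)) (1+2m<2k m<k)

evenIndex<oddIndex : ∀ {r} (m : Fin r) → toℕ (evenIndex m) < toℕ (oddIndex m)
evenIndex<oddIndex m =
  subst₂ _<_ (sym (toℕ-evenIndex m)) (sym (toℕ-oddIndex m)) (n<1+n (2 * toℕ m))

lemma4 : (r : ℕ) → r ≥ 1 → (M : Mat₂ (2 * r) (2 * r))
       → (∀ (i j : Fin (2 * r)) → toℕ j < toℕ i → M i j ≡ true)
       → (∀ (i j : Fin (2 * r)) → toℕ i < toℕ j → M i j ≡ false)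
       → RankAtLeast M r
lemma4 r _ M lower upper = oddIndex , Unitriangular⇒LinIndep submatrix
  where
  submatrix : Unitriangular (λ m → M (oddIndex m)) evenIndex
  submatrix = record
    { above    = λ m k m<k → upper (oddIndex m) (evenIndex k) (oddIndex<evenIndex m<k)
    ; diagonal = λ m → lower (oddIndex m) (evenIndex m) (evenIndex<oddIndex m)
    }
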